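{- Let $\mathcal S$ be a small-step quadrant model with kernel $K(x,y)$. If there are series $A(x)\in\mathbb R[[x,t]]$, $B(y)\in\mathbb R[[y,t]]$ and $C(x,y)\in\mathbb R[[x,y,t]]$ such that $A(x)-B(y)=K(x,y)C(x,y)$, then $A(x)=B(y)\in\mathbb R[[t]]$ and $C(x,y)=0$.
   Context: The kernel is $K(x,y)=xy\big(t\sum_{(i,j)\in\mathcal S}w_{i,j}x^iy^j-1\big)$ for a set $\mathcal S\subseteq\{ -1,0,1\}^2\setminus\{(0,0)\}$ with weights $w_{i,j}$. -}

module Defs where

open import Level using (Level)
open import Data.Nat using (ℕ; zero; suc; _∸_)
open import Data.Fin using (Fin; zero; suc)
open import Data.Bool using (Bool; true; false; if_then_else_)
open import Data.Maybe using (Maybe; just; nothing)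
open import Relation.Binary.PropositionalEquality using (_≡_)
open import Algebra.Bundles using (CommutativeRing)

-- Steps (i,j) ∈ {-1,0,1}² are encoded by Fin 3 × Fin 3,
-- Fin index 0 ↦ -1, 1 ↦ 0, 2 ↦ +1.
-- A small-step quadrant model: a step set S ⊆ {-1,0,1}² \ {(0,0)}
-- (given by its characteristic function) with weights w_{i,j} in the
-- coefficient ring.
record Model {c ℓ : Level} (R : CommutativeRing c ℓ) : Set c where
  open CommutativeRing R using (Carrier)
  field
    inS      : Fin 3 → Fin 3 → Bool
    noOrigin : inS (suc zero) (suc zero) ≡ false
    w        : Fin 3 → Fin 3 → Carrier

module _ {c ℓ : Level} (R : CommutativeRing c ℓ) where
  open CommutativeRing R using (Carrier; _+_; _*_; -_; _-_; 0#; 1#)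

  -- Formal power series in x,t (resp. x,y,t): coefficient functions.
  -- Series2 i n  = [x^i t^n],   Series3 i j n = [x^i y^j t^n].
  Series2 : Set c
  Series2 = ℕ → ℕ → Carrier

  Series3 : Set c
  Series3 = ℕ → ℕ → ℕ → Carrier

  sumTo : ℕ → (ℕ → Carrier) → Carrier
  sumTo zero    f = f zero
  sumTo (suc n) f = sumTo n f + f (suc n)

  _⊛_ : Series3 → Series3 → Series3
  (F ⊛ G) a b n =
    sumTo a λ i → sumTo b λ j → sumTo n λ k →
      F i j k * G (a ∸ i) (b ∸ j) (n ∸ k)

  inX : Series2 → Series3
  inX A i zero    n = A i n
  inX A i (suc j) n = 0#

  inY : Series2 → Series3
  inY B zero    j n = B j n
  inY B (suc i) j n = 0#

  _⊖_ : Series3 → Series3 → Series3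
  (F ⊖ G) a b n = F a b n - G a b n

  private
    digit : ℕ → Maybe (Fin 3)
    digit zero                = just zero
    digit (suc zero)          = just (suc zero)
    digit (suc (suc zero))    = just (suc (suc zero))
    digit (suc (suc (suc _))) = nothing

  -- The kernel K(x,y) = xy (t Σ_{(i,j)∈S} w_{i,j} x^i y^j − 1)
  --                   = Σ_{(i,j)∈S} w_{i,j} x^{i+1} y^{j+1} t − xy
  -- as a (polynomial) element of R[[x,y,t]].
  kernel : Model R → Series3
  kernel M a b (suc zero) = weighted (digit a) (digit b)
    where
      open Model M
      weighted : Maybe (Fin 3) → Maybe (Fin 3) → Carrier
      weighted (just p) (just q) = if inS p q then w p q else 0#
      weighted _        _        = 0#
  kernel M (suc zero) (suc zero) zero = - 1#
  kernel M a b zero = 0#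
  kernel M a b (suc (suc n)) = 0#

-- Only the t⁰-part −xy of the kernel matters. Every other monomial of K raises the
-- t-degree, so the coefficient of x^(a+1) y^(b+1) tⁿ in K C is −[x^a y^b tⁿ] C plus
-- coefficients of C of lower t-degree. The left-hand side A(x) − B(y) has no such
-- mixed monomials, so strong induction on n gives C = 0, and then A(x) = B(y)
-- forces both to be constant in x and y.
module Submission where

open import Defs
open import Level using (Level; _⊔_)
open import Data.Nat using (ℕ; zero; suc; _∸_; _≤_; _<_; z≤n; s≤s; s≤s⁻¹)
open import Data.Nat.Properties
  using (≤-refl; m≤n⇒m≤1+n; m≤n⇒m<n∨m≡n; <⇒≢; n≢0⇒n>0; ∸-monoʳ-<)
open import Data.Nat.Induction using (<-rec)
open import Data.Product using (_×_; _,_)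
open import Data.Sum using (_⊎_; inj₁; inj₂)
open import Data.Empty using (⊥-elim)
open import Function using (_∘_)
open import Relation.Binary.PropositionalEquality using (_≢_)
  renaming (refl to ≡-refl; sym to ≡-sym)
open import Algebra.Bundles using (CommutativeRing)
import Algebra.Properties.Ring as RingProperties
import Relation.Binary.Reasoning.Setoid as SetoidReasoning

module Coefficients {c ℓ : Level} (R : CommutativeRing c ℓ) where
  open CommutativeRing R hiding (zero)
  open RingProperties ring using (-1*x≈-x; -‿injective; -0#≈0#)
  open SetoidReasoning setoid

  sumTo-cong : ∀ n {f g : ℕ → Carrier} → (∀ k → f k ≈ g k) → sumTo R n f ≈ sumTo R n g
  sumTo-cong zero    f≈g = f≈g zero
  sumTo-cong (suc n) f≈g = +-cong (sumTo-cong n f≈g) (f≈g (suc n))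

  sumTo-zero : ∀ n {f : ℕ → Carrier} → (∀ k → k ≤ n → f k ≈ 0#) → sumTo R n f ≈ 0#
  sumTo-zero zero    f≈0 = f≈0 zero z≤n
  sumTo-zero (suc n) f≈0 =
    trans (+-cong (sumTo-zero n (λ k → f≈0 k ∘ m≤n⇒m≤1+n)) (f≈0 (suc n) ≤-refl))
          (+-identityʳ 0#)

  sumTo-single : ∀ n {m} {f : ℕ → Carrier} → m ≤ n →
                 (∀ k → k ≤ n → k ≢ m → f k ≈ 0#) → sumTo R n f ≈ f m
  sumTo-single zero z≤n _ = refl
  sumTo-single (suc n) {m} {f} m≤1+n f≈0 with m≤n⇒m<n∨m≡n m≤1+n
  ... | inj₁ m<1+n = begin
    sumTo R n f + f (suc n) ≈⟨ +-cong (sumTo-single n (s≤s⁻¹ m<1+n) (λ k → f≈0 k ∘ m≤n⇒m≤1+n))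
                                      (f≈0 (suc n) ≤-refl (<⇒≢ m<1+n ∘ ≡-sym)) ⟩
    f m + 0#                ≈⟨ +-identityʳ (f m) ⟩
    f m                     ∎
  ... | inj₂ ≡-refl = begin
    sumTo R n f + f (suc n) ≈⟨ +-congʳ (sumTo-zero n (λ k k≤n → f≈0 k (m≤n⇒m≤1+n k≤n) (<⇒≢ (s≤s k≤n)))) ⟩
    0# + f (suc n)          ≈⟨ +-identityˡ (f (suc n)) ⟩
    f (suc n)               ∎

  ⊛-zeroʳ : ∀ (F G : Series3 R) → (∀ a b n → G a b n ≈ 0#) → ∀ a b n → (_⊛_ R F G) a b n ≈ 0#
  ⊛-zeroʳ F G G≈0 a b n =
    sumTo-zero a λ i _ → sumTo-zero b λ j _ → sumTo-zero n λ k _ →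
      trans (*-congˡ (G≈0 (a ∸ i) (b ∸ j) (n ∸ k))) (zeroʳ (F i j k))

  record HasConstantTermMinusXY (K : Series3 R) : Set (c ⊔ ℓ) where
    field
      at-xy     : K 1 1 0 ≈ - 1#
      elsewhere : ∀ i j → i ≢ 1 ⊎ j ≢ 1 → K i j 0 ≈ 0#

  module _ {K : Series3 R} (K₀ : HasConstantTermMinusXY K) (C : Series3 R) where
    open HasConstantTermMinusXY K₀

    ⊛-tSum≈t⁰Term : ∀ {n} → (∀ {m} → m < n → ∀ a b → C a b m ≈ 0#) →
                     ∀ a b i j → sumTo R n (λ k → K i j k * C a b (n ∸ k)) ≈ K i j 0 * C a b n
    ⊛-tSum≈t⁰Term {n} C<n≈0 a b i j = sumTo-single n z≤n λ k k≤n k≢0 →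
      trans (*-congˡ (C<n≈0 (∸-monoʳ-< (n≢0⇒n>0 k≢0) k≤n) a b)) (zeroʳ (K i j k))

    ⊛-mixedCoefficient : ∀ {n} → (∀ {m} → m < n → ∀ a b → C a b m ≈ 0#) →
                         ∀ a b → (_⊛_ R K C) (suc a) (suc b) n ≈ - C a b n
    ⊛-mixedCoefficient {n} C<n≈0 a b = begin
      (_⊛_ R K C) (suc a) (suc b) n
        ≈⟨ sumTo-cong (suc a) (λ i → sumTo-cong (suc b) (λ j →
             ⊛-tSum≈t⁰Term C<n≈0 (suc a ∸ i) (suc b ∸ j) i j)) ⟩
      sumTo R (suc a) (λ i → sumTo R (suc b) (λ j → K i j 0 * C (suc a ∸ i) (suc b ∸ j) n))
        ≈⟨ sumTo-single (suc a) (s≤s z≤n) (λ i _ i≢1 →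
             sumTo-zero (suc b) (λ j _ → vanishes (elsewhere i j (inj₁ i≢1)))) ⟩
      sumTo R (suc b) (λ j → K 1 j 0 * C a (suc b ∸ j) n)
        ≈⟨ sumTo-single (suc b) (s≤s z≤n) (λ j _ j≢1 → vanishes (elsewhere 1 j (inj₂ j≢1))) ⟩
      K 1 1 0 * C a b n ≈⟨ *-congʳ at-xy ⟩
      - 1# * C a b n    ≈⟨ -1*x≈-x (C a b n) ⟩
      - C a b n         ∎
      where
        vanishes : ∀ {x y} → x ≈ 0# → x * y ≈ 0#
        vanishes {y = y} x≈0 = trans (*-congʳ x≈0) (zeroˡ y)

    ⊛-mixedCoefficients≈0⇒≈0 : (∀ a b n → (_⊛_ R K C) (suc a) (suc b) n ≈ 0#) → ∀ a b n → C a b n ≈ 0#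
    ⊛-mixedCoefficients≈0⇒≈0 KC≈0 a b n = <-rec (λ n → ∀ a b → C a b n ≈ 0#) step n a b
      where
        step : ∀ n → (∀ {m} → m < n → ∀ a b → C a b m ≈ 0#) → ∀ a b → C a b n ≈ 0#
        step n C<n≈0 a b = -‿injective (begin
          - C a b n                     ≈⟨ ⊛-mixedCoefficient C<n≈0 a b ⟨
          (_⊛_ R K C) (suc a) (suc b) n ≈⟨ KC≈0 a b n ⟩
          0#                            ≈⟨ -0#≈0# ⟨
          - 0#                          ∎)

  kernel-hasConstantTermMinusXY : (M : Model R) → HasConstantTermMinusXY (kernel R M)
  kernel-hasConstantTermMinusXY M = record { at-xy = refl ; elsewhere = elsewhere }
    where
      elsewhere : ∀ i j → i ≢ 1 ⊎ j ≢ 1 → kernel R M i j 0 ≈ 0#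
      elsewhere zero          j             _          = refl
      elsewhere (suc (suc i)) j             _          = refl
      elsewhere 1             zero          _          = refl
      elsewhere 1             (suc (suc j)) _          = refl
      elsewhere 1             1             (inj₁ 1≢1) = ⊥-elim (1≢1 ≡-refl)
      elsewhere 1             1             (inj₂ 1≢1) = ⊥-elim (1≢1 ≡-refl)

lemma4p13 : {c ℓ : Level} (R : CommutativeRing c ℓ) (M : Model R)
    (A B : Series2 R) (C : Series3 R) →
    (∀ a b n → CommutativeRing._≈_ R
    (_⊖_ R (inX R A) (inY R B) a b n)
    (_⊛_ R (kernel R M) C a b n)) →
    ((∀ i n → CommutativeRing._≈_ R (A (suc i) n) (CommutativeRing.0# R))
    × (∀ j n → CommutativeRing._≈_ R (B (suc j) n) (CommutativeRing.0# R))
    × (∀ n → CommutativeRing._≈_ R (A zero n) (B zero n)))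
    × (∀ a b n → CommutativeRing._≈_ R (C a b n) (CommutativeRing.0# R))
lemma4p13 R M A B C A-B≈KC =
  ( (λ i n → x∙y⁻¹≈ε⇒x≈y _ _ (A-B≈0 (suc i) 0 n))
  , (λ j n → sym (x∙y⁻¹≈ε⇒x≈y _ _ (A-B≈0 0 (suc j) n)))
  , (λ n → x∙y⁻¹≈ε⇒x≈y _ _ (A-B≈0 0 0 n)) )
  , C≈0
  where
    open CommutativeRing R using (sym; trans; -‿inverseʳ; 0#)
    open Coefficients R
    open RingProperties (CommutativeRing.ring R) using (x∙y⁻¹≈ε⇒x≈y)

    C≈0 : ∀ a b n → CommutativeRing._≈_ R (C a b n) 0#
    C≈0 = ⊛-mixedCoefficients≈0⇒≈0 (kernel-hasConstantTermMinusXY M) C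
            (λ a b n → trans (sym (A-B≈KC (suc a) (suc b) n)) (-‿inverseʳ 0#))

    A-B≈0 : ∀ a b n → CommutativeRing._≈_ R (_⊖_ R (inX R A) (inY R B) a b n) 0#
    A-B≈0 a b n = trans (A-B≈KC a b n) (⊛-zeroʳ (kernel R M) C C≈0 a b n)
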